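{- Let $n \ge 3$, let $G=K_n$ be the complete graph of order $n$, and let $f: V(G_1)\to V(G_2)$ be a function with $|f(V(G_1))| = s$, where $1 < s < n$. Then $\dim(C(K_n, f)) = 2n-2-s$.
   Context: For a connected graph $H$, a set $S \subseteq V(H)$ is a resolving set if for every two distinct vertices $x,y$ of $H$ there is $s \in S$ with $d_H(x,s) \neq d_H(y,s)$; the metric dimension $\dim(H)$ is the minimum cardinality of a resolving set of $H$. Given a graph $G$, let $G_1$ and $G_2$ be disjoint copies of $G$ and let $f: V(G_1)\to V(G_2)$ be a function. The functigraph $C(G,f)$ is the graph with vertex set $V(G_1)\cup V(G_2)$ and edge set $E(G_1)\cup E(G_2)\cup\{uv \mid u \in V(G_1),\ v=f(u)\}$. -}

module Defs where

open import Data.Nat using (ℕ; zero; suc; _≤_)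
open import Data.Fin using (Fin)
open import Data.Sum using (_⊎_; inj₁; inj₂)
open import Data.Product using (_×_; ∃; ∃-syntax; Σ-syntax)
open import Data.List using (List; length)
open import Data.List.Membership.Propositional using (_∈_)
open import Data.List.Relation.Unary.Unique.Propositional using (Unique)
open import Relation.Binary.PropositionalEquality using (_≡_; _≢_)
open import Function.Bundles using (_⇔_)

record Graph : Set₁ where
  field
    V   : Set
    Adj : V → V → Set

open Graph public

data Walk (G : Graph) : V G → V G → ℕ → Set where
  here : ∀ {x} → Walk G x x zero
  step : ∀ {x y z k} → Adj G x y → Walk G y z k → Walk G x z (suc k)

Dist : (G : Graph) → V G → V G → ℕ → Set
Dist G x y k = Walk G x y k × (∀ m → Walk G x y m → k ≤ m)

Connected : Graph → Set
Connected G = ∀ x y → ∃[ k ] Walk G x y k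

Resolving : (G : Graph) → List (V G) → Set
Resolving G S = ∀ x y → x ≢ y →
  ∃[ s ] (s ∈ S × ∃[ k ] ∃[ l ] (Dist G x s k × Dist G y s l × k ≢ l))

IsMetricDim : (G : Graph) → ℕ → Set
IsMetricDim G d =
  (∃[ S ] (Unique S × Resolving G S × length S ≡ d)) ×
  (∀ S → Unique S → Resolving G S → d ≤ length S)

Complete : ℕ → Graph
Complete n = record { V = Fin n ; Adj = λ a b → a ≢ b }

-- Functigraph C(G,f) for G on Fin n: G₁ = inj₁ copy, G₂ = inj₂ copy.
Functigraph : {n : ℕ} → ((Fin n → Fin n → Set)) → (Fin n → Fin n) → Graph
Functigraph {n} A f = record { V = Fin n ⊎ Fin n ; Adj = adj }
  where
  adj : Fin n ⊎ Fin n → Fin n ⊎ Fin n → Set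
  adj (inj₁ a) (inj₁ b) = A a b
  adj (inj₂ a) (inj₂ b) = A a b
  adj (inj₁ a) (inj₂ b) = f a ≡ b
  adj (inj₂ b) (inj₁ a) = f a ≡ b

ImageSize : {n : ℕ} → (Fin n → Fin n) → ℕ → Set
ImageSize {n} f s =
  ∃[ L ] (Unique L × length L ≡ s × (∀ b → (b ∈ L) ⇔ (∃[ a ] f a ≡ b)))

module Submission where

-- Every two vertices of C(K_n, f) are adjacent or have a common neighbour, so
-- the distance between distinct vertices is 1 (adjacent) or 2 (not adjacent).
-- Hence a vertex t separates x from y iff t is one of them, or t is adjacent
-- to exactly one of them; "twins" (vertices outside S with the same neighbours
-- in S) must coincide when S is resolving.

open import Defs
open import Data.Nat using (ℕ; suc; _≤_; _<_; _+_; _∸_; z≤n; s≤s)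
open import Data.Nat.Properties
  using (≤-trans; ≤-refl; <⇒≱; ≤-reflexive; ≤-antisym; +-suc; +-comm; +-monoˡ-≤; +-monoʳ-≤; ∸-+-assoc; m≤n+o⇒m∸n≤o; m+n∸n≡m; module ≤-Reasoning)
open import Data.Fin using (Fin; _≟_)
import Data.Fin as Fin
open import Data.Fin.Properties using (injective⇒≤; pigeonhole; <⇒≢; ¬∀⟶∃¬; any?)
open import Data.Bool using (Bool; true; false)
open import Data.Sum using (_⊎_; inj₁; inj₂)
open import Data.Sum.Properties using (inj₁-injective; inj₂-injective; ≡-dec)
open import Data.Product using (_×_; _,_; ∃-syntax; proj₁; proj₂)
open import Data.Empty using (⊥; ⊥-elim)
open import Data.List using (List; []; _∷_; length; lookup; filter; map; _++_; allFin)
open import Data.List.Properties using (length-++; length-map; length-tabulate)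
open import Data.List.Membership.Propositional using (_∈_)
open import Data.List.Membership.Propositional.Properties
  using (∈-lookup; ∈-filter⁺; ∈-filter⁻; ∈-map⁺; ∈-map⁻; ∈-++⁺ˡ; ∈-++⁺ʳ; ∈-allFin)
open import Data.List.Membership.Setoid.Properties using (index-injective)
import Data.List.Membership.DecPropositional as DecMembership
open import Data.List.Relation.Unary.Any using (here; there; index)
import Data.List.Relation.Unary.All as All
open import Data.List.Relation.Unary.All.Properties using (¬Any⇒All¬)
open import Data.List.Relation.Unary.AllPairs using (_∷_)
open import Data.List.Relation.Unary.Unique.Propositional using (Unique)
import Data.List.Relation.Unary.Unique.Propositional.Properties as Unique
open import Relation.Binary.Definitions using (DecidableEquality)
open import Relation.Binary.PropositionalEquality
open import Relation.Nullary using (¬_; Dec; yes; no; ¬?)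
open import Relation.Nullary.Decidable using (_×-dec_)
open import Relation.Unary using (Pred; Decidable)
open import Function.Bundles using (_⇔_; mk⇔; Equivalence)
open import Function.Definitions using (Injective)
open import Level using (0ℓ)

unique-lookup-injective : {A : Set} {xs : List A} → Unique xs →
  ∀ i j → lookup xs i ≡ lookup xs j → i ≡ j
unique-lookup-injective {xs = _ ∷ _} _ Fin.zero Fin.zero _ = refl
unique-lookup-injective {xs = _ ∷ _} (x∉xs ∷ _) Fin.zero (Fin.suc j) e =
  ⊥-elim (All.lookup x∉xs (∈-lookup j) e)
unique-lookup-injective {xs = _ ∷ _} (x∉xs ∷ _) (Fin.suc i) Fin.zero e =
  ⊥-elim (All.lookup x∉xs (∈-lookup i) (sym e))
unique-lookup-injective {xs = _ ∷ _} (_ ∷ u) (Fin.suc i) (Fin.suc j) e =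
  cong Fin.suc (unique-lookup-injective u i j e)

-- A map that is injective on a duplicate-free list xs and sends it into ys
-- shows |xs| ≤ |ys|: positions in xs inject into positions in ys.
injection-length : {A B : Set} {xs : List A} {ys : List B} (g : A → B) → Unique xs →
  (∀ {x} → x ∈ xs → g x ∈ ys) →
  (∀ {x y} → x ∈ xs → y ∈ xs → g x ≡ g y → x ≡ y) →
  length xs ≤ length ys
injection-length {B = B} {xs = xs} {ys} g xs-unique into g-injective =
  injective⇒≤ position-injective
  where
  position : Fin (length xs) → Fin (length ys)
  position i = index (into (∈-lookup i))

  position-injective : Injective _≡_ _≡_ position
  position-injective {i} {j} e =
    unique-lookup-injective xs-unique i j
      (g-injective (∈-lookup i) (∈-lookup j)
        (index-injective (setoid B) (into (∈-lookup i)) (into (∈-lookup j)) e))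

sublist-length : {A : Set} {xs ys : List A} → Unique xs →
  (∀ {x} → x ∈ xs → x ∈ ys) → length xs ≤ length ys
sublist-length xs-unique sub = injection-length (λ x → x) xs-unique sub (λ _ _ e → e)

length-allFin : ∀ n → length (allFin n) ≡ n
length-allFin n = length-tabulate (λ i → i)

filter-split-length : {A : Set} {P : Pred A 0ℓ} (P? : Decidable P) (xs : List A) →
  length (filter P? xs) + length (filter (λ x → ¬? (P? x)) xs) ≡ length xs
filter-split-length P? [] = refl
filter-split-length P? (x ∷ xs) with P? x
... | yes _ = cong suc (filter-split-length P? xs)
... | no _ = trans (+-suc _ _) (cong suc (filter-split-length P? xs))

module Complements {A : Set} (_≟ₐ_ : DecidableEquality A)
  (all : List A) (all-unique : Unique all) where

  open DecMembership _≟ₐ_ using (_∈?_)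

  complement : List A → List A
  complement S = filter (λ x → ¬? (x ∈? S)) all

  inside : List A → List A
  inside S = filter (_∈? S) all

  length-≤-complement : ∀ S → length all ≤ length S + length (complement S)
  length-≤-complement S = begin
    length all                                      ≡⟨ sym (filter-split-length (_∈? S) all) ⟩
    length (inside S) + length (complement S)       ≤⟨ +-monoˡ-≤ _ inside-≤ ⟩
    length S + length (complement S)                ∎
    where
    open ≤-Reasoning
    inside-≤ : length (inside S) ≤ length S
    inside-≤ = sublist-length (Unique.filter⁺ (_∈? S) all-unique)
                 (λ m → proj₂ (∈-filter⁻ (_∈? S) {xs = all} m))

  complement-length : (∀ x → x ∈ all) → ∀ C → Unique C →
    length (complement C) + length C ≡ length all
  complement-length complete C C-unique = begin
    length (complement C) + length C           ≡⟨ +-comm (length (complement C)) _ ⟩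
    length C + length (complement C)           ≡⟨ cong (_+ length (complement C)) (sym inside≡C) ⟩
    length (inside C) + length (complement C)  ≡⟨ filter-split-length (_∈? C) all ⟩
    length all                                 ∎
    where
    open ≡-Reasoning
    inside≡C : length (inside C) ≡ length C
    inside≡C = ≤-antisym
      (sublist-length (Unique.filter⁺ (_∈? C) all-unique)
        (λ m → proj₂ (∈-filter⁻ (_∈? C) {xs = all} m)))
      (sublist-length C-unique (λ {x} m → ∈-filter⁺ (_∈? C) (complete x) m))

distance-code : {P Q : Set} → Dec P → Dec Q → ℕ
distance-code (yes _) _ = 0
distance-code (no _) (yes _) = 1
distance-code (no _) (no _) = 2

module Diameter≤2 (G : Graph) (_≟ᵥ_ : DecidableEquality (V G))
  (adj? : ∀ x y → Dec (Adj G x y))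
  (common-neighbour : ∀ x y → x ≢ y → ¬ Adj G x y → ∃[ z ] (Adj G x z × Adj G z y)) where

  d : V G → V G → ℕ
  d x y = distance-code (x ≟ᵥ y) (adj? x y)

  d-walk : ∀ x y → Walk G x y (d x y)
  d-walk x y with x ≟ᵥ y | adj? x y
  ... | yes refl | _ = here
  ... | no _ | yes x~y = step x~y here
  ... | no x≢y | no x≁y with common-neighbour x y x≢y x≁y
  ... | _ , x~z , z~y = step x~z (step z~y here)

  d≤2 : ∀ x y → d x y ≤ 2
  d≤2 x y with x ≟ᵥ y | adj? x y
  ... | yes _ | _ = z≤n
  ... | no _ | yes _ = s≤s z≤n
  ... | no _ | no _ = ≤-refl

  d-self : ∀ x → d x x ≡ 0
  d-self x with x ≟ᵥ x
  ... | yes _ = refl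
  ... | no x≢x = ⊥-elim (x≢x refl)

  d-shortest : ∀ {x y m} → Walk G x y m → d x y ≤ m
  d-shortest {x} here = ≤-reflexive (d-self x)
  d-shortest {x} {y} (step x~y here) with x ≟ᵥ y | adj? x y
  ... | yes _ | _ = z≤n
  ... | no _ | yes _ = ≤-refl
  ... | no _ | no x≁y = ⊥-elim (x≁y x~y)
  d-shortest {x} {y} (step _ (step _ _)) = ≤-trans (d≤2 x y) (s≤s (s≤s z≤n))

  dist-is-d : ∀ {x y k} → Dist G x y k → k ≡ d x y
  dist-is-d {x} {y} (w , minimal) = ≤-antisym (minimal _ (d-walk x y)) (d-shortest w)

  d-is-dist : ∀ x y → Dist G x y (d x y)
  d-is-dist x y = d-walk x y , λ _ → d-shortest

  d-distinct : ∀ {x y} → x ≢ y → d x y ≢ 0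
  d-distinct {x} {y} x≢y with x ≟ᵥ y | adj? x y
  ... | yes x≡y | _ = λ _ → x≢y x≡y
  ... | no _ | yes _ = λ ()
  ... | no _ | no _ = λ ()

  d-adjacent : ∀ {x y} → x ≢ y → Adj G x y → d x y ≡ 1
  d-adjacent {x} {y} x≢y x~y with x ≟ᵥ y | adj? x y
  ... | yes x≡y | _ = ⊥-elim (x≢y x≡y)
  ... | no _ | yes _ = refl
  ... | no _ | no x≁y = ⊥-elim (x≁y x~y)

  d-nonadjacent : ∀ {x y} → x ≢ y → ¬ Adj G x y → d x y ≡ 2
  d-nonadjacent {x} {y} x≢y x≁y with x ≟ᵥ y | adj? x y
  ... | yes x≡y | _ = ⊥-elim (x≢y x≡y)
  ... | no _ | yes x~y = ⊥-elim (x≁y x~y)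
  ... | no _ | no _ = refl

  d-adjacent≢2 : ∀ {x y} → Adj G x y → d x y ≢ 2
  d-adjacent≢2 {x} {y} x~y with x ≟ᵥ y | adj? x y
  ... | yes _ | _ = λ ()
  ... | no _ | yes _ = λ ()
  ... | no _ | no x≁y = ⊥-elim (x≁y x~y)

  Separates : List (V G) → V G → V G → Set
  Separates S x y = ∃[ t ] (t ∈ S × d x t ≢ d y t)

  resolving⇒separating : ∀ {S} → Resolving G S → ∀ x y → x ≢ y → Separates S x y
  resolving⇒separating R x y x≢y with R x y x≢y
  ... | t , t∈S , _ , _ , dist-x , dist-y , k≢l =
    t , t∈S , λ e → k≢l (trans (dist-is-d dist-x) (trans e (sym (dist-is-d dist-y))))

  separating⇒resolving : ∀ {S} → (∀ x y → x ≢ y → Separates S x y) → Resolving G S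
  separating⇒resolving sep x y x≢y with sep x y x≢y
  ... | t , t∈S , d≢ = t , t∈S , d x t , d y t , d-is-dist x t , d-is-dist y t , d≢

  separates-sym : ∀ {S x y} → Separates S x y → Separates S y x
  separates-sym (t , t∈S , d≢) = t , t∈S , λ e → d≢ (sym e)

  member-separates : ∀ {S x y} → x ∈ S → x ≢ y → Separates S x y
  member-separates {x = x} x∈S x≢y =
    x , x∈S , λ e → d-distinct (λ y≡x → x≢y (sym y≡x)) (trans (sym e) (d-self x))

  neighbour-separates : ∀ {S x y t} → t ∈ S → Adj G x t → y ≢ t → ¬ Adj G y t →
    Separates S x y
  neighbour-separates t∈S x~t y≢t y≁t =
    _ , t∈S , λ e → d-adjacent≢2 x~t (trans e (d-nonadjacent y≢t y≁t))

  outside-≢ : ∀ {S : List (V G)} {x t} → ¬ x ∈ S → t ∈ S → x ≢ t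
  outside-≢ x∉S t∈S refl = x∉S t∈S

  twins-coincide : ∀ {S x y} → Resolving G S → ¬ x ∈ S → ¬ y ∈ S →
    (∀ {t} → t ∈ S → Adj G x t ⇔ Adj G y t) → x ≡ y
  twins-coincide {S} {x} {y} R x∉S y∉S same with x ≟ᵥ y
  ... | yes x≡y = x≡y
  ... | no x≢y with resolving⇒separating R x y x≢y
  ... | t , t∈S , d≢ = ⊥-elim (d≢ same-distance)
    where
    x≢t : x ≢ t
    x≢t = outside-≢ x∉S t∈S
    y≢t : y ≢ t
    y≢t = outside-≢ y∉S t∈S
    same-distance-by : Dec (Adj G x t) → d x t ≡ d y t
    same-distance-by (yes x~t) = trans (d-adjacent x≢t x~t)
      (sym (d-adjacent y≢t (Equivalence.to (same t∈S) x~t)))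
    same-distance-by (no x≁t) = trans (d-nonadjacent x≢t x≁t)
      (sym (d-nonadjacent y≢t (λ y~t → x≁t (Equivalence.from (same t∈S) y~t))))
    same-distance : d x t ≡ d y t
    same-distance = same-distance-by (adj? x t)

both-hold : {P Q : Set} → P → Q → P ⇔ Q
both-hold p q = mk⇔ (λ _ → q) (λ _ → p)

both-fail : {P Q : Set} → ¬ P → ¬ Q → P ⇔ Q
both-fail ¬p ¬q = mk⇔ (λ p → ⊥-elim (¬p p)) (λ q → ⊥-elim (¬q q))

module FunctigraphOfComplete (n : ℕ) (f : Fin n → Fin n) where

  G : Graph
  G = Functigraph (Graph.Adj (Complete n)) f

  Vertex : Set
  Vertex = Fin n ⊎ Fin n

  _≟ᵥ_ : DecidableEquality Vertex
  _≟ᵥ_ = ≡-dec _≟_ _≟_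

  open DecMembership _≟ᵥ_ using (_∈?_)

  adj? : ∀ x y → Dec (Adj G x y)
  adj? (inj₁ a) (inj₁ b) = ¬? (a ≟ b)
  adj? (inj₂ a) (inj₂ b) = ¬? (a ≟ b)
  adj? (inj₁ a) (inj₂ b) = f a ≟ b
  adj? (inj₂ b) (inj₁ a) = f a ≟ b

  -- Distinct vertices of the same copy are adjacent; a ∈ G₁ and b ∈ G₂ that
  -- are not adjacent share the neighbour f(a) ∈ G₂.
  common-neighbour : ∀ x y → x ≢ y → ¬ Adj G x y → ∃[ z ] (Adj G x z × Adj G z y)
  common-neighbour (inj₁ a) (inj₁ b) x≢y x≁y = ⊥-elim (x≁y (λ a≡b → x≢y (cong inj₁ a≡b)))
  common-neighbour (inj₂ a) (inj₂ b) x≢y x≁y = ⊥-elim (x≁y (λ a≡b → x≢y (cong inj₂ a≡b)))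
  common-neighbour (inj₁ a) (inj₂ b) _ fa≢b = inj₂ (f a) , refl , fa≢b
  common-neighbour (inj₂ b) (inj₁ a) _ fa≢b = inj₂ (f a) , (λ b≡fa → fa≢b (sym b≡fa)) , refl

  open Diameter≤2 G _≟ᵥ_ adj? common-neighbour public

  vertices : List Vertex
  vertices = map inj₁ (allFin n) ++ map inj₂ (allFin n)

  vertices-unique : Unique vertices
  vertices-unique =
    Unique.++⁺ (Unique.map⁺ inj₁-injective (Unique.allFin⁺ n))
               (Unique.map⁺ inj₂-injective (Unique.allFin⁺ n))
               λ (in₁ , in₂) → copies-disjoint in₁ in₂
    where
    copies-disjoint : ∀ {v : Vertex} {as bs} → v ∈ map inj₁ as → v ∈ map inj₂ bs → ⊥
    copies-disjoint in₁ in₂ with ∈-map⁻ inj₁ in₁ | ∈-map⁻ inj₂ in₂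
    ... | _ , _ , refl | _ , _ , ()

  vertices-complete : ∀ x → x ∈ vertices
  vertices-complete (inj₁ a) = ∈-++⁺ˡ (∈-map⁺ inj₁ (∈-allFin a))
  vertices-complete (inj₂ b) = ∈-++⁺ʳ (map inj₁ (allFin n)) (∈-map⁺ inj₂ (∈-allFin b))

  vertices-length : length vertices ≡ n + n
  vertices-length = begin
    length vertices                                              ≡⟨ length-++ (map inj₁ (allFin n)) ⟩
    length (map inj₁ (allFin n)) + length (map inj₂ (allFin n))  ≡⟨ cong₂ _+_ (length-map inj₁ (allFin n)) (length-map inj₂ (allFin n)) ⟩
    length (allFin n) + length (allFin n)                        ≡⟨ cong₂ _+_ (length-allFin n) (length-allFin n) ⟩
    n + n                                                        ∎
    where open ≡-Reasoning

  open Complements _≟ᵥ_ vertices vertices-unique public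

  module Twins (S : List Vertex) (S-resolving : Resolving G S) where

    G₁-twins : ∀ {a a'} → ¬ inj₁ a ∈ S → ¬ inj₁ a' ∈ S →
      (∀ {c} → inj₂ c ∈ S → (f a ≡ c) ⇔ (f a' ≡ c)) → a ≡ a'
    G₁-twins {a} {a'} a∉S a'∉S same-image = inj₁-injective
      (twins-coincide S-resolving a∉S a'∉S same-neighbours)
      where
      same-neighbours : ∀ {t} → t ∈ S → Adj G (inj₁ a) t ⇔ Adj G (inj₁ a') t
      same-neighbours {inj₁ c} c∈S =
        both-hold (λ a≡c → outside-≢ a∉S c∈S (cong inj₁ a≡c))
                  (λ a'≡c → outside-≢ a'∉S c∈S (cong inj₁ a'≡c))
      same-neighbours {inj₂ c} c∈S = same-image c∈S

    G₂-twins : ∀ {b b'} → ¬ inj₂ b ∈ S → ¬ inj₂ b' ∈ S →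
      (∀ {c} → inj₁ c ∈ S → (f c ≡ b) ⇔ (f c ≡ b')) → b ≡ b'
    G₂-twins {b} {b'} b∉S b'∉S same-preimage = inj₂-injective
      (twins-coincide S-resolving b∉S b'∉S same-neighbours)
      where
      same-neighbours : ∀ {t} → t ∈ S → Adj G (inj₂ b) t ⇔ Adj G (inj₂ b') t
      same-neighbours {inj₁ c} c∈S = same-preimage c∈S
      same-neighbours {inj₂ c} c∈S =
        both-hold (λ b≡c → outside-≢ b∉S c∈S (cong inj₂ b≡c))
                  (λ b'≡c → outside-≢ b'∉S c∈S (cong inj₂ b'≡c))

  -- Lower bound: if L contains the image of f, at most |L| + 2 vertices lie
  -- outside a resolving list S, so 2n ≤ |S| + |L| + 2.
  module LowerBound (S : List Vertex) (S-resolving : Resolving G S)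
    (L : List (Fin n)) (covers : ∀ a → f a ∈ L) where

    open Twins S S-resolving

    same-image-outside : ∀ {a a'} → ¬ inj₁ a ∈ S → ¬ inj₁ a' ∈ S → f a ≡ f a' → a ≡ a'
    same-image-outside a∉S a'∉S fa≡fa' =
      G₁-twins a∉S a'∉S (λ _ → mk⇔ (trans (sym fa≡fa')) (trans fa≡fa'))

    unhit-outside : ∀ {b b'} → ¬ inj₂ b ∈ S → ¬ inj₂ b' ∈ S → ¬ b ∈ L → ¬ b' ∈ L → b ≡ b'
    unhit-outside b∉S b'∉S b∉L b'∉L =
      G₂-twins b∉S b'∉S (λ {c} _ → both-fail (λ fc≡b → b∉L (subst (_∈ L) fc≡b (covers c)))
                                               (λ fc≡b' → b'∉L (subst (_∈ L) fc≡b' (covers c))))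

    -- Two G₂-vertices outside S, each with a preimage outside S, are equal:
    -- the preimages are twins, since their images avoid S.
    free-preimages : ∀ {a a' b b'} → ¬ inj₂ b ∈ S → ¬ inj₂ b' ∈ S →
      ¬ inj₁ a ∈ S → ¬ inj₁ a' ∈ S → f a ≡ b → f a' ≡ b' → b ≡ b'
    free-preimages {a} {a'} b∉S b'∉S a∉S a'∉S refl refl =
      cong f (G₁-twins a∉S a'∉S λ c∈S →
        both-fail (λ fa≡c → outside-≢ b∉S c∈S (cong inj₂ fa≡c))
                  (λ fa'≡c → outside-≢ b'∉S c∈S (cong inj₂ fa'≡c)))

    data Class (b : Fin n) : Set where
      unhit   : ¬ b ∈ L → Class b
      free    : ∀ a → ¬ inj₁ a ∈ S → f a ≡ b → Class b
      covered : b ∈ L → (∀ a → f a ≡ b → inj₁ a ∈ S) → Class b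

    classify : ∀ b → Class b
    classify b with DecMembership._∈?_ _≟_ b L
    ... | no b∉L = unhit b∉L
    ... | yes b∈L with any? (λ a → ¬? (inj₁ a ∈? S) ×-dec (f a ≟ b))
    ... | yes (a , a∉S , fa≡b) = free a a∉S fa≡b
    ... | no no-free = covered b∈L preimages-in-S
      where
      preimages-in-S : ∀ a → f a ≡ b → inj₁ a ∈ S
      preimages-in-S a fa≡b with inj₁ a ∈? S
      ... | yes a∈S = a∈S
      ... | no a∉S = ⊥-elim (no-free (a , a∉S , fa≡b))

    Code : Set
    Code = Fin n ⊎ Bool

    codes : List Code
    codes = inj₂ true ∷ inj₂ false ∷ map inj₁ L

    class-code : ∀ {b} → Class b → Code
    class-code (unhit _) = inj₂ false
    class-code (free _ _ _) = inj₂ true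
    class-code {b} (covered _ _) = inj₁ b

    code : Vertex → Code
    code (inj₁ a) = inj₁ (f a)
    code (inj₂ b) = class-code (classify b)

    code-in-codes : ∀ x → code x ∈ codes
    code-in-codes (inj₁ a) = there (there (∈-map⁺ inj₁ (covers a)))
    code-in-codes (inj₂ b) = class-code-in-codes (classify b)
      where
      class-code-in-codes : ∀ {b} (κ : Class b) → class-code κ ∈ codes
      class-code-in-codes (unhit _) = there (here refl)
      class-code-in-codes (free _ _ _) = here refl
      class-code-in-codes (covered b∈L _) = there (there (∈-map⁺ inj₁ b∈L))

    class-code-injective : ∀ {b b'} → ¬ inj₂ b ∈ S → ¬ inj₂ b' ∈ S →
      (κ : Class b) (κ' : Class b') → class-code κ ≡ class-code κ' → b ≡ b'
    class-code-injective b∉S b'∉S (unhit b∉L) (unhit b'∉L) _ = unhit-outside b∉S b'∉S b∉L b'∉L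
    class-code-injective b∉S b'∉S (free _ a∉S fa≡b) (free _ a'∉S fa'≡b') _ =
      free-preimages b∉S b'∉S a∉S a'∉S fa≡b fa'≡b'
    class-code-injective _ _ (covered _ _) (covered _ _) e = inj₁-injective e
    class-code-injective _ _ (unhit _) (free _ _ _) ()
    class-code-injective _ _ (unhit _) (covered _ _) ()
    class-code-injective _ _ (free _ _ _) (unhit _) ()
    class-code-injective _ _ (free _ _ _) (covered _ _) ()
    class-code-injective _ _ (covered _ _) (unhit _) ()
    class-code-injective _ _ (covered _ _) (free _ _ _) ()

    mixed-codes-differ : ∀ {a b} → ¬ inj₁ a ∈ S → (κ : Class b) → inj₁ (f a) ≢ class-code κ
    mixed-codes-differ a∉S (covered _ preimages-in-S) e = a∉S (preimages-in-S _ (inj₁-injective e))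

    code-injective : ∀ {x y} → ¬ x ∈ S → ¬ y ∈ S → code x ≡ code y → x ≡ y
    code-injective {inj₁ a} {inj₁ a'} a∉S a'∉S e = cong inj₁ (same-image-outside a∉S a'∉S (inj₁-injective e))
    code-injective {inj₁ a} {inj₂ b} a∉S _ e = ⊥-elim (mixed-codes-differ a∉S (classify b) e)
    code-injective {inj₂ b} {inj₁ a} _ a∉S e = ⊥-elim (mixed-codes-differ a∉S (classify b) (sym e))
    code-injective {inj₂ b} {inj₂ b'} b∉S b'∉S e =
      cong inj₂ (class-code-injective b∉S b'∉S (classify b) (classify b') e)

    outside-length : length (complement S) ≤ 2 + length L
    outside-length = ≤-trans
      (injection-length code (Unique.filter⁺ outside? vertices-unique)
        (λ {x} _ → code-in-codes x)
        (λ x∈ y∈ → code-injective (proj₂ (∈-filter⁻ outside? {xs = vertices} x∈))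
                                   (proj₂ (∈-filter⁻ outside? {xs = vertices} y∈))))
      (≤-reflexive (cong (λ k → 2 + k) (length-map inj₁ L)))
      where
      outside? = λ x → ¬? (x ∈? S)

    lower-bound : n + n ≤ length S + (2 + length L)
    lower-bound = begin
      n + n                              ≡⟨ sym vertices-length ⟩
      length vertices                    ≤⟨ length-≤-complement S ⟩
      length S + length (complement S)   ≤⟨ +-monoʳ-≤ (length S) outside-length ⟩
      length S + (2 + length L)          ∎
      where open ≤-Reasoning

  -- Upper bound: if L lists the image of f without repetitions and
  -- 1 < |L| < n, the complement of an explicit set of |L| + 2 vertices resolves.
  module UpperBound (L : List (Fin n)) (L-unique : Unique L)
    (image : ∀ b → (b ∈ L) ⇔ (∃[ a ] f a ≡ b))
    (two-values : 1 < length L) (not-onto : length L < n) where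

    image-member : ∀ a → f a ∈ L
    image-member a = Equivalence.from (image (f a)) (a , refl)

    -- As |L| < n, two vertices of G₁ share their image.
    collision : ∃[ a₁ ] ∃[ a₂ ] (a₁ ≢ a₂ × f a₁ ≡ f a₂)
    collision with pigeonhole not-onto (λ a → index (image-member a))
    ... | i , j , i<j , same-index =
      i , j , <⇒≢ i<j , index-injective (setoid (Fin n)) (image-member i) (image-member j) same-index

    -- As |L| < n, some vertex of G₂ is outside the image.
    outside-image : ∃[ b₀ ] ¬ b₀ ∈ L
    outside-image = ¬∀⟶∃¬ n (_∈ L) (λ b → DecMembership._∈?_ _≟_ b L) onto-impossible
      where
      onto-impossible : (∀ b → b ∈ L) → ⊥
      onto-impossible onto = <⇒≱ not-onto
        (subst (_≤ length L) (length-allFin n) (sublist-length (Unique.allFin⁺ n) (λ {b} _ → onto b)))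

    -- As |L| ≥ 2, every value is missed by some image.
    another-value : ∀ b → ∃[ a ] f a ≢ b
    another-value b = from-two-values L L-unique two-values (λ m → Equivalence.to (image _) m)
      where
      from-two-values : ∀ K → Unique K → 1 < length K →
        (∀ {c} → c ∈ K → ∃[ a ] f a ≡ c) → ∃[ a ] f a ≢ b
      from-two-values [] _ () _
      from-two-values (_ ∷ []) _ (s≤s ()) _
      from-two-values (x ∷ y ∷ _) ((x≢y All.∷ _) ∷ _) _ preimage with b ≟ x
      ... | yes refl = let (a , fa≡y) = preimage (there (here refl))
                       in a , λ fa≡x → x≢y (trans (sym fa≡x) fa≡y)
      ... | no b≢x = let (a , fa≡x) = preimage (here refl)
                     in a , λ fa≡b → b≢x (trans (sym fa≡b) fa≡x)

    a₁ a₂ : Fin n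
    a₁ = proj₁ collision
    a₂ = proj₁ (proj₂ collision)

    a₂≢a₁ : a₂ ≢ a₁
    a₂≢a₁ a₂≡a₁ = proj₁ (proj₂ (proj₂ collision)) (sym a₂≡a₁)

    fa₁≡fa₂ : f a₁ ≡ f a₂
    fa₁≡fa₂ = proj₂ (proj₂ (proj₂ collision))

    b₀ : Fin n
    b₀ = proj₁ outside-image

    non-neighbour-avoiding-a₁ : ∀ b → ∃[ c ] (c ≢ a₁ × f c ≢ b)
    non-neighbour-avoiding-a₁ b with f a₁ ≟ b
    ... | yes fa₁≡b = let (c , fc≢b) = another-value b
                      in c , (λ c≡a₁ → fc≢b (trans (cong f c≡a₁) fa₁≡b)) , fc≢b
    ... | no fa₁≢b = a₂ , a₂≢a₁ , λ fa₂≡b → fa₁≢b (trans fa₁≡fa₂ fa₂≡b)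

    -- Every image value has a preimage other than a₁ (a₂ replaces a₁).
    preimage-avoiding-a₁ : ∀ {b} → b ∈ L → ∃[ c ] (c ≢ a₁ × f c ≡ b)
    preimage-avoiding-a₁ b∈L with Equivalence.to (image _) b∈L
    ... | c , fc≡b with c ≟ a₁
    ... | yes refl = a₂ , a₂≢a₁ , trans (sym fa₁≡fa₂) fc≡b
    ... | no c≢a₁ = c , c≢a₁ , fc≡b

    excluded : List Vertex
    excluded = inj₁ a₁ ∷ inj₂ b₀ ∷ map inj₂ L

    S₀ : List Vertex
    S₀ = complement excluded

    excluded-unique : Unique excluded
    excluded-unique = ¬Any⇒All¬ _ a₁-fresh ∷ ¬Any⇒All¬ _ b₀-fresh ∷ Unique.map⁺ inj₂-injective L-unique
      where
      a₁-fresh : ¬ inj₁ a₁ ∈ inj₂ b₀ ∷ map inj₂ L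
      a₁-fresh (here ())
      a₁-fresh (there m) with ∈-map⁻ inj₂ m
      ... | _ , _ , ()
      b₀-fresh : ¬ inj₂ b₀ ∈ map inj₂ L
      b₀-fresh m with ∈-map⁻ inj₂ m
      ... | _ , b∈L , refl = proj₂ outside-image b∈L

    S₀-unique : Unique S₀
    S₀-unique = Unique.filter⁺ (λ x → ¬? (x ∈? excluded)) vertices-unique

    kept : ∀ {x} → ¬ x ∈ excluded → x ∈ S₀
    kept {x} x∉ = ∈-filter⁺ (λ x → ¬? (x ∈? excluded)) (vertices-complete x) x∉

    kept-G₁ : ∀ {c} → c ≢ a₁ → inj₁ c ∈ S₀
    kept-G₁ {c} c≢a₁ = kept c-not-excluded
      where
      c-not-excluded : ¬ inj₁ c ∈ excluded
      c-not-excluded (here c≡a₁) = c≢a₁ (inj₁-injective c≡a₁)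
      c-not-excluded (there (here ()))
      c-not-excluded (there (there m)) with ∈-map⁻ inj₂ m
      ... | _ , _ , ()

    data Excluded : Vertex → Set where
      twin   : Excluded (inj₁ a₁)
      missed : Excluded (inj₂ b₀)
      hit    : ∀ {b} → b ∈ L → Excluded (inj₂ b)

    excluded-view : ∀ {x} → ¬ x ∈ S₀ → Excluded x
    excluded-view {x} x∉S₀ with x ∈? excluded
    ... | no x∉ = ⊥-elim (x∉S₀ (kept x∉))
    ... | yes (here refl) = twin
    ... | yes (there (here refl)) = missed
    ... | yes (there (there m)) with ∈-map⁻ inj₂ m
    ... | _ , b∈L , refl = hit b∈L

    twin-separated : ∀ b → Separates S₀ (inj₁ a₁) (inj₂ b)
    twin-separated b with non-neighbour-avoiding-a₁ b
    ... | c , c≢a₁ , fc≢b = neighbour-separates (kept-G₁ c≢a₁) (λ a₁≡c → c≢a₁ (sym a₁≡c)) (λ ()) fc≢b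

    hit-separated : ∀ {b b'} → b ∈ L → b ≢ b' → Separates S₀ (inj₂ b) (inj₂ b')
    hit-separated b∈L b≢b' with preimage-avoiding-a₁ b∈L
    ... | c , c≢a₁ , fc≡b =
      neighbour-separates (kept-G₁ c≢a₁) fc≡b (λ ()) (λ fc≡b' → b≢b' (trans (sym fc≡b) fc≡b'))

    excluded-separated : ∀ {x y} → Excluded x → Excluded y → x ≢ y → Separates S₀ x y
    excluded-separated twin twin x≢y = ⊥-elim (x≢y refl)
    excluded-separated twin missed _ = twin-separated b₀
    excluded-separated twin (hit {b} _) _ = twin-separated b
    excluded-separated missed twin _ = separates-sym (twin-separated b₀)
    excluded-separated missed missed x≢y = ⊥-elim (x≢y refl)
    excluded-separated missed (hit b∈L) x≢y =
      separates-sym (hit-separated b∈L (λ b≡b₀ → x≢y (cong inj₂ (sym b≡b₀))))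
    excluded-separated (hit {b} _) twin _ = separates-sym (twin-separated b)
    excluded-separated (hit b∈L) missed x≢y = hit-separated b∈L (λ b≡b₀ → x≢y (cong inj₂ b≡b₀))
    excluded-separated (hit b∈L) (hit _) x≢y = hit-separated b∈L (λ b≡b' → x≢y (cong inj₂ b≡b'))

    S₀-resolving : Resolving G S₀
    S₀-resolving = separating⇒resolving S₀-separates
      where
      S₀-separates : ∀ x y → x ≢ y → Separates S₀ x y
      S₀-separates x y x≢y with x ∈? S₀ | y ∈? S₀
      ... | yes x∈S₀ | _ = member-separates x∈S₀ x≢y
      ... | no _ | yes y∈S₀ = separates-sym (member-separates y∈S₀ (λ y≡x → x≢y (sym y≡x)))
      ... | no x∉S₀ | no y∉S₀ = excluded-separated (excluded-view x∉S₀) (excluded-view y∉S₀) x≢y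

    S₀-length : length S₀ + (2 + length L) ≡ n + n
    S₀-length = begin
      length S₀ + (2 + length L)           ≡⟨ cong (λ k → length S₀ + (2 + k)) (sym (length-map inj₂ L)) ⟩
      length S₀ + length excluded          ≡⟨ complement-length vertices-complete excluded excluded-unique ⟩
      length vertices                      ≡⟨ vertices-length ⟩
      n + n                                ∎
      where open ≡-Reasoning

size-from-complement : ∀ {m N} s → m + (2 + s) ≡ N → m ≡ N ∸ 2 ∸ s
size-from-complement {m} {N} s e = begin
  m                      ≡⟨ sym (m+n∸n≡m m (2 + s)) ⟩
  m + (2 + s) ∸ (2 + s)  ≡⟨ cong (_∸ (2 + s)) e ⟩
  N ∸ (2 + s)            ≡⟨ sym (∸-+-assoc N 2 s) ⟩
  N ∸ 2 ∸ s              ∎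
  where open ≡-Reasoning

size-bound : ∀ {m N} s → N ≤ m + (2 + s) → N ∸ 2 ∸ s ≤ m
size-bound {m} {N} s N≤ = subst (_≤ m) (sym (∸-+-assoc N 2 s))
  (m≤n+o⇒m∸n≤o N (2 + s) (subst (N ≤_) (+-comm m (2 + s)) N≤))

-- The S₀ of the upper bound realises 2n - 2 - s and the lower bound holds for
-- every resolving S (the hypothesis 3 ≤ n follows from 1 < s < n).
theorem3p6 : (n : ℕ) → 3 ≤ n → (f : Fin n → Fin n) → (s : ℕ) → ImageSize f s →
    1 < s → s < n →
    IsMetricDim (Functigraph (Graph.Adj (Complete n)) f) (n + n ∸ 2 ∸ s)
theorem3p6 n _ f s (L , L-unique , refl , image) 1<s s<n =
  (S₀ , S₀-unique , S₀-resolving , size-from-complement s S₀-length) ,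
  λ S _ S-resolving → size-bound s (LowerBound.lower-bound S S-resolving L image-member)
  where
  open FunctigraphOfComplete n f
  open UpperBound L L-unique image 1<s s<n
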